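{- Let $\overrightarrow{G}$ be a deeply critical oriented clique with an extending partition $V(\overrightarrow{G})=X_1\sqcup X_2\sqcup X_3$. Then the $6$-extension $\overrightarrow{G}_6$ of $\overrightarrow{G}$ (with respect to this partition) admits an extending partition; namely $X_1'\sqcup X_2'\sqcup X_3'$ with $X_i'=X_i\cup\{x_i^-,x_i^+\}$ for $i\in\{1,2,3\}$.
   Context: An oriented graph is a directed graph with no loops and no directed cycles of length two. An oriented $k$-colouring of $\overrightarrow{G}$ is a function $\phi:V(\overrightarrow{G})\to\{1,\dots,k\}$ with (i) $\phi(x)\neq\phi(y)$ for every arc $xy$, and (ii) for all arcs $xy,uv$, if $\phi(x)=\phi(v)$ then $\phi(y)\neq\phi(u)$; $\chi_o(\overrightarrow{G})$ is the least such $k$. A deeply critical oriented clique is an oriented graph with $\chi_o(\overrightarrow{G})=|V(\overrightarrow{G})|$ and $\chi_o(\overrightarrow{G}-xy)=\chi_o(\overrightarrow{G})-2$ for every arc $xy$. $N^+(u)$ and $N^-(v)$ denote out- and in-neighbourhoods. An extending partition of $\overrightarrow{G}$ is a partition $V(\overrightarrow{G})=X_1\sqcup X_2\sqcup X_3$ such that, for each $i\in\{1,2,3\}$ with indices taken modulo $3$: (i) there is no arc from a vertex of $X_{i+1}$ to a vertex of $X_i$; (ii) for each $u\in X_i$ there is $v\in X_{i+1}$ with $N^-(v)\cap X_i=\{u\}$; (iii) for each $v\in X_{i+1}$ there is $u\in X_i$ with $N^+(u)\cap X_{i+1}=\{v\}$. An oriented graph is extendable if it admits an extending partition. The $6$-extension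 $\overrightarrow{G}_6$ is obtained from $\overrightarrow{G}$ by adding six new vertices $x_1^-,x_1^+,x_2^-,x_2^+,x_3^-,x_3^+$, the arcs $x_1^-x_2^+$, $x_1^+x_2^-$, $x_2^-x_3^+$, $x_2^+x_3^-$, $x_3^-x_1^+$, $x_3^+x_1^-$, and, for each $i\in\{1,2,3\}$ and each $x\in X_i$, the arcs $x_i^-x$ and $xx_i^+$. -}

module Defs where

open import Data.Nat using (ℕ; _<_; _∸_)
open import Data.Fin using (Fin; zero; suc)
open import Data.Product using (_×_; ∃-syntax)
open import Relation.Nullary using (¬_)
open import Relation.Binary.PropositionalEquality using (_≡_)

record Digraph (V : Set) : Set₁ where
  field
    Arc : V → V → Set
open Digraph public

Oriented : {V : Set} → Digraph V → Set
Oriented {V} G = (∀ (x : V) → ¬ Arc G x x) × (∀ (x y : V) → Arc G x y → ¬ Arc G y x)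

IsOrientedColouring : {V : Set} → Digraph V → (k : ℕ) → (V → Fin k) → Set
IsOrientedColouring {V} G k φ =
  (∀ (x y : V) → Arc G x y → ¬ φ x ≡ φ y) ×
  (∀ (x y u v : V) → Arc G x y → Arc G u v → φ x ≡ φ v → ¬ φ y ≡ φ u)

OrientedColourable : {V : Set} → Digraph V → ℕ → Set
OrientedColourable {V} G k = ∃[ φ ] IsOrientedColouring G k φ

OrientedChromaticNumber : {V : Set} → Digraph V → ℕ → Set
OrientedChromaticNumber G k =
  OrientedColourable G k × (∀ j → j < k → ¬ OrientedColourable G j)

deleteArc : {n : ℕ} → Digraph (Fin n) → Fin n → Fin n → Digraph (Fin n)
deleteArc G x y = record { Arc = λ u v → Arc G u v × ¬ (u ≡ x × v ≡ y) }

DeeplyCriticalOrientedClique : (n : ℕ) → Digraph (Fin n) → Set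
DeeplyCriticalOrientedClique n G =
  Oriented G ×
  OrientedChromaticNumber G n ×
  (∀ (x y : Fin n) → Arc G x y → OrientedChromaticNumber (deleteArc G x y) (n ∸ 2))

next : Fin 3 → Fin 3
next zero = suc zero
next (suc zero) = suc (suc zero)
next (suc (suc zero)) = zero

-- A partition V = X₁ ⊔ X₂ ⊔ X₃ given by the part-index function p (x ∈ X_{p x}).
IsExtendingPartition : {V : Set} → Digraph V → (V → Fin 3) → Set
IsExtendingPartition {V} G p =
  (∀ (u v : V) → Arc G u v → ¬ p u ≡ next (p v)) ×
  (∀ (u : V) → ∃[ v ] (p v ≡ next (p u) × Arc G u v ×
                       (∀ (w : V) → p w ≡ p u → Arc G w v → w ≡ u))) ×
  (∀ (v : V) → ∃[ u ] (p v ≡ next (p u) × Arc G u v ×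
                       (∀ (w : V) → p w ≡ p v → Arc G u w → w ≡ v)))

data ExtV (n : ℕ) : Set where
  old   : Fin n → ExtV n
  minus : Fin 3 → ExtV n
  plus  : Fin 3 → ExtV n

-- Arcs of the 6-extension w.r.t. the partition p.
-- x₁⁻x₂⁺, x₂⁻x₃⁺, x₃⁻x₁⁺ are minus i → plus (next i);
-- x₁⁺x₂⁻, x₂⁺x₃⁻, x₃⁺x₁⁻ are plus i → minus (next i).
data ExtArc {n : ℕ} (G : Digraph (Fin n)) (p : Fin n → Fin 3) : ExtV n → ExtV n → Set where
  oldArc   : ∀ {x y} → Arc G x y → ExtArc G p (old x) (old y)
  minusOld : ∀ {i x} → p x ≡ i → ExtArc G p (minus i) (old x)
  oldPlus  : ∀ {i x} → p x ≡ i → ExtArc G p (old x) (plus i)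
  minusPlus : ∀ i → ExtArc G p (minus i) (plus (next i))
  plusMinus : ∀ i → ExtArc G p (plus i) (minus (next i))

sixExtension : {n : ℕ} → Digraph (Fin n) → (Fin n → Fin 3) → Digraph (ExtV n)
sixExtension G p = record { Arc = ExtArc G p }

extPartition : {n : ℕ} → (Fin n → Fin 3) → ExtV n → Fin 3
extPartition p (old x) = p x
extPartition p (minus i) = i
extPartition p (plus i) = i

module Submission where

open import Defs
open import Data.Nat using (ℕ)
open import Data.Fin using (Fin; zero; suc)
open import Data.Product using (∃-syntax; _×_; _,_)
open import Data.Sum using (_⊎_; inj₁; inj₂)
open import Data.Empty using (⊥-elim)
open import Relation.Nullary using (¬_)
open import Relation.Binary.PropositionalEquality using (_≡_; refl; sym; trans; cong)

NoBackwardArcs : {V : Set} → Digraph V → (V → Fin 3) → Set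
NoBackwardArcs {V} G p = ∀ (u v : V) → Arc G u v → ¬ p u ≡ next (p v)

PrivateSuccessors : {V : Set} → Digraph V → (V → Fin 3) → Set
PrivateSuccessors {V} G p =
  ∀ (u : V) → ∃[ v ] (p v ≡ next (p u) × Arc G u v ×
                      (∀ (w : V) → p w ≡ p u → Arc G w v → w ≡ u))

PrivatePredecessors : {V : Set} → Digraph V → (V → Fin 3) → Set
PrivatePredecessors {V} G p =
  ∀ (v : V) → ∃[ u ] (p v ≡ next (p u) × Arc G u v ×
                      (∀ (w : V) → p w ≡ p v → Arc G u w → w ≡ v))

i≢next[i] : ∀ i → ¬ i ≡ next i
i≢next[i] zero ()
i≢next[i] (suc zero) ()
i≢next[i] (suc (suc zero)) ()

i≢next[next[i]] : ∀ i → ¬ i ≡ next (next i)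
i≢next[next[i]] zero ()
i≢next[next[i]] (suc zero) ()
i≢next[next[i]] (suc (suc zero)) ()

next-surjective : ∀ j → ∃[ i ] next i ≡ j
next-surjective zero = suc (suc zero) , refl
next-surjective (suc zero) = zero , refl
next-surjective (suc (suc zero)) = suc zero , refl

module SixExtension {n : ℕ} (G : Digraph (Fin n)) (p : Fin n → Fin 3) where

  private
    P : ExtV n → Fin 3
    P = extPartition p

  arc-into-old : ∀ {w y} → ExtArc G p w (old y) →
                 (∃[ x ] (w ≡ old x × Arc G x y)) ⊎ P w ≡ p y
  arc-into-old (oldArc a) = inj₁ (_ , refl , a)
  arc-into-old (minusOld e) = inj₂ (sym e)

  arc-into-plus : ∀ {w j} → ExtArc G p w (plus j) → ¬ P w ≡ j → w ≡ minus (P w)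
  arc-into-plus (oldPlus e) w∉Xⱼ = ⊥-elim (w∉Xⱼ e)
  arc-into-plus (minusPlus i) _ = refl

  arc-into-minus : ∀ {w j} → ExtArc G p w (minus j) → w ≡ plus (P w)
  arc-into-minus (plusMinus i) = refl

  arc-from-old : ∀ {x w} → ExtArc G p (old x) w →
                 (∃[ y ] (w ≡ old y × Arc G x y)) ⊎ P w ≡ p x
  arc-from-old (oldArc a) = inj₁ (_ , refl , a)
  arc-from-old (oldPlus e) = inj₂ (sym e)

  arc-from-minus : ∀ {i w} → ExtArc G p (minus i) w → P w ≡ i ⊎ w ≡ plus (next i)
  arc-from-minus (minusOld e) = inj₁ e
  arc-from-minus (minusPlus i) = inj₂ refl

  arc-from-plus : ∀ {i w} → ExtArc G p (plus i) w → w ≡ minus (next i)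
  arc-from-plus (plusMinus i) = refl

  noBackwardArcs : NoBackwardArcs G p → NoBackwardArcs (sixExtension G p) P
  noBackwardArcs back _ _ (oldArc a) = back _ _ a
  noBackwardArcs back _ _ (minusOld {i} e) q = i≢next[i] i (trans q (cong next e))
  noBackwardArcs back _ _ (oldPlus {i} e) q = i≢next[i] i (trans (sym e) q)
  noBackwardArcs back _ _ (minusPlus i) = i≢next[next[i]] i
  noBackwardArcs back _ _ (plusMinus i) = i≢next[next[i]] i

  privateSuccessors : PrivateSuccessors G p → PrivateSuccessors (sixExtension G p) P
  privateSuccessors succ (old x) with succ x
  ... | y , y∈next , x→y , private-y = old y , y∈next , oldArc x→y , unique
    where
    unique : ∀ w → P w ≡ p x → ExtArc G p w (old y) → w ≡ old x
    unique w w∈Xₓ w→y with arc-into-old w→y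
    ... | inj₁ (x′ , refl , x′→y) = cong old (private-y x′ w∈Xₓ x′→y)
    ... | inj₂ w∈Xᵧ = ⊥-elim (i≢next[i] (p x) (trans (sym w∈Xₓ) (trans w∈Xᵧ y∈next)))
  privateSuccessors _ (minus i) = plus (next i) , refl , minusPlus i , unique
    where
    unique : ∀ w → P w ≡ i → ExtArc G p w (plus (next i)) → w ≡ minus i
    unique w refl w→i⁺ = arc-into-plus w→i⁺ (i≢next[i] (P w))
  privateSuccessors _ (plus i) = minus (next i) , refl , plusMinus i , unique
    where
    unique : ∀ w → P w ≡ i → ExtArc G p w (minus (next i)) → w ≡ plus i
    unique w refl w→i⁻ = arc-into-minus w→i⁻

  privatePredecessors : PrivatePredecessors G p → PrivatePredecessors (sixExtension G p) P
  privatePredecessors pred (old y) with pred y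
  ... | x , y∈next , x→y , private-x = old x , y∈next , oldArc x→y , unique
    where
    unique : ∀ w → P w ≡ p y → ExtArc G p (old x) w → w ≡ old y
    unique w w∈Xᵧ x→w with arc-from-old x→w
    ... | inj₁ (y′ , refl , x→y′) = cong old (private-x y′ w∈Xᵧ x→y′)
    ... | inj₂ w∈Xₓ = ⊥-elim (i≢next[i] (p x) (trans (sym w∈Xₓ) (trans w∈Xᵧ y∈next)))
  privatePredecessors _ (minus j) with next-surjective j
  ... | i , refl = plus i , refl , plusMinus i , λ w _ i⁺→w → arc-from-plus i⁺→w
  privatePredecessors _ (plus j) with next-surjective j
  ... | i , refl = minus i , refl , minusPlus i , unique
    where
    unique : ∀ w → P w ≡ next i → ExtArc G p (minus i) w → w ≡ plus (next i)
    unique w w∈next i⁻→w with arc-from-minus i⁻→w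
    ... | inj₁ w∈Xᵢ = ⊥-elim (i≢next[i] i (trans (sym w∈Xᵢ) w∈next))
    ... | inj₂ w≡i⁺ = w≡i⁺

open SixExtension

lemma2 : (n : ℕ) (G : Digraph (Fin n)) (p : Fin n → Fin 3) →
    DeeplyCriticalOrientedClique n G →
    IsExtendingPartition G p →
    IsExtendingPartition (sixExtension G p) (extPartition p)
lemma2 n G p _ (back , succ , pred) =
  noBackwardArcs G p back , privateSuccessors G p succ , privatePredecessors G p pred
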